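{- Let $T$ be a complete theory in a language of unary predicates (with equality), $\mathcal{M}\models T$, and $\mathcal{H}=(M,H(\mathcal{M}))$. For any family of sets $A_j\subseteq M$, each of which is the set of realizations in $\mathcal{M}$ of some isolated 1-type $p_j$, the restriction of $\mathcal{H}$ to $\bigcup_jA_j$ is the disjoint complete union of the restrictions $\mathcal{H}_j$ of $\mathcal{H}$ to the sets $A_j$.
   Context: A hypergraph is a pair $(X,Y)$ with $Y\subseteq\mathcal{P}(X)$. $H(\mathcal{M})$ is the set of universes of elementary submodels of $\mathcal{M}$. The restriction of $(X,Y)$ to $A\subseteq X$ is $(A,\{y\cap A\mid y\in Y\})$. The complete union of hypergraphs $(X_i,Y_i)$, $i\in I$, is $(\bigcup_iX_i,\{\bigcup_iZ_i\mid Z_i\in Y_i\})$; it is disjoint if the $X_i$ are pairwise disjoint. -}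

module Defs where

import Level
open import Level using (Level; 0ℓ) renaming (suc to lsuc)
open import Data.Nat using (ℕ; suc)
open import Data.Fin using (Fin; zero; suc)
open import Data.Product using (Σ; Σ-syntax; _×_; _,_)
open import Data.Empty using (⊥)
open import Data.Unit using (⊤)
open import Data.Sum using (_⊎_)
open import Relation.Binary.PropositionalEquality using (_≡_; _≢_)

Subset : Set → Set₁
Subset X = X → Set

_≋_ : {X : Set} → Subset X → Subset X → Set
_≋_ {X} A B = (x : X) → (A x → B x) × (B x → A x)

_∩_ : {X : Set} → Subset X → Subset X → Subset X
(A ∩ B) x = A x × B x

⋃ : {X J : Set} → (J → Subset X) → Subset X
⋃ {J = J} A x = Σ[ j ∈ J ] A j x

Disjoint : {X : Set} → Subset X → Subset X → Set
Disjoint {X} A B = (x : X) → A x → B x → ⊥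

-- First-order language consisting only of unary predicate symbols
-- (indexed by P) and equality.  Formulas with n free variables
-- (de Bruijn, Fin n).

data Formula (P : Set) : ℕ → Set where
  eq   : ∀ {n} → Fin n → Fin n → Formula P n
  rel  : ∀ {n} → P → Fin n → Formula P n
  fls  : ∀ {n} → Formula P n
  _⇒_  : ∀ {n} → Formula P n → Formula P n → Formula P n
  _∧_  : ∀ {n} → Formula P n → Formula P n → Formula P n
  _∨_  : ∀ {n} → Formula P n → Formula P n → Formula P n
  all  : ∀ {n} → Formula P (suc n) → Formula P n
  ex   : ∀ {n} → Formula P (suc n) → Formula P n

neg : ∀ {P n} → Formula P n → Formula P n
neg φ = φ ⇒ fls

Sentence : Set → Set
Sentence P = Formula P 0

Theory : Set → Set₁
Theory P = Sentence P → Set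

record Structure (P : Set) : Set₁ where
  field
    Carrier : Set
    Rel     : P → Carrier → Set
    point   : Carrier        -- structures are nonempty
open Structure public

extend : {M : Set} {n : ℕ} → M → (Fin n → M) → Fin (suc n) → M
extend a v zero    = a
extend a v (suc i) = v i

-- Satisfaction in the structure with carrier M, predicates R, where the
-- quantifiers are relativised to the subset D ⊆ M (for D = everything
-- this is ordinary satisfaction in M; for general D it is satisfaction
-- in the induced substructure on D, which is a substructure since the
-- language is purely relational).
SatIn : {P M : Set} → (P → M → Set) → Subset M →
        {n : ℕ} → Formula P n → (Fin n → M) → Set
SatIn R D (eq i j)  v = v i ≡ v j
SatIn R D (rel r i) v = R r (v i)
SatIn R D fls       v = ⊥
SatIn R D (φ ⇒ ψ)   v = SatIn R D φ v → SatIn R D ψ v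
SatIn R D (φ ∧ ψ)   v = SatIn R D φ v × SatIn R D ψ v
SatIn R D (φ ∨ ψ)   v = SatIn R D φ v ⊎ SatIn R D ψ v
SatIn {M = M} R D (all φ) v = (a : M) → D a → SatIn R D φ (extend a v)
SatIn {M = M} R D (ex φ)  v = Σ[ a ∈ M ] (D a × SatIn R D φ (extend a v))

Sat : {P : Set} (𝓜 : Structure P) {n : ℕ} → Formula P n → (Fin n → Carrier 𝓜) → Set
Sat 𝓜 = SatIn (Rel 𝓜) (λ _ → ⊤)

noVars : {M : Set} → Fin 0 → M
noVars ()

_⊨_ : {P : Set} → Structure P → Sentence P → Set
𝓜 ⊨ σ = Sat 𝓜 σ noVars

_⊨T_ : {P : Set} → Structure P → Theory P → Set
𝓜 ⊨T T = ∀ σ → T σ → 𝓜 ⊨ σ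

_⊩_ : {P : Set} → Theory P → Sentence P → Set₁
_⊩_ {P} T σ = (𝓝 : Structure P) → 𝓝 ⊨T T → 𝓝 ⊨ σ

Complete : {P : Set} → Theory P → Set₁
Complete {P} T = (Σ[ 𝓝 ∈ Structure P ] 𝓝 ⊨T T)
               × ((σ : Sentence P) → (T ⊩ σ) ⊎ (T ⊩ neg σ))

oneVar : {M : Set} → M → Fin 1 → M
oneVar a zero = a

Realises : {P : Set} (𝓝 : Structure P) → (Formula P 1 → Set) → Carrier 𝓝 → Set
Realises {P} 𝓝 p a = (ψ : Formula P 1) → p ψ → Sat 𝓝 ψ (oneVar a)

IsOneType : {P : Set} → Theory P → (Formula P 1 → Set) → Set₁
IsOneType {P} T p =
    (Σ[ 𝓝 ∈ Structure P ] (𝓝 ⊨T T × Σ[ a ∈ Carrier 𝓝 ] Realises 𝓝 p a))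
  × ((φ : Formula P 1) → p φ ⊎ p (neg φ))

Isolated : {P : Set} → Theory P → (Formula P 1 → Set) → Set₁
Isolated {P} T p =
  Σ[ φ ∈ Formula P 1 ] (p φ × ((ψ : Formula P 1) → p ψ → T ⊩ all (φ ⇒ ψ)))

Realisations : {P : Set} (𝓜 : Structure P) → (Formula P 1 → Set) → Subset (Carrier 𝓜)
Realisations 𝓜 p = Realises 𝓜 p

-- Elementary submodels: N ⊆ M (nonempty; any subset is the universe of
-- a substructure, the language being purely relational) such that for
-- all formulas and all tuples from N, N ⊨ φ[v] iff 𝓜 ⊨ φ[v].

IsElementarySubmodelUniverse : {P : Set} (𝓜 : Structure P) → Subset (Carrier 𝓜) → Set
IsElementarySubmodelUniverse {P} 𝓜 N =
    (Σ[ a ∈ Carrier 𝓜 ] N a)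
  × ((n : ℕ) (φ : Formula P n) (v : Fin n → Carrier 𝓜) → ((i : Fin n) → N (v i)) →
       (SatIn (Rel 𝓜) N φ v → Sat 𝓜 φ v) × (Sat 𝓜 φ v → SatIn (Rel 𝓜) N φ v))

-- Hypergraphs (X, Y) with Y ⊆ 𝒫(X); subsets of X are predicates and
-- all notions are taken up to extensional equality of subsets.

record Hypergraph (X : Set) : Set₂ where
  field
    Vert : Subset X
    Edge : Subset X → Set₁
open Hypergraph public

HM : {P : Set} (𝓜 : Structure P) → Hypergraph (Carrier 𝓜)
Vert (HM 𝓜) _ = ⊤
Edge (HM 𝓜) N = Level.Lift (lsuc 0ℓ) (IsElementarySubmodelUniverse 𝓜 N)

restrict : {X : Set} → Hypergraph X → Subset X → Hypergraph X
Vert (restrict H A) = A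
Edge (restrict H A) Z = Σ[ y ∈ Subset _ ] (Edge H y × (Z ≋ (y ∩ A)))

completeUnion : {X J : Set} → (J → Hypergraph X) → Hypergraph X
Vert (completeUnion Hs) = ⋃ (λ j → Vert (Hs j))
Edge (completeUnion {X} {J} Hs) Z =
  Σ[ Zs ∈ (J → Subset X) ] (((j : J) → Edge (Hs j) (Zs j)) × (Z ≋ ⋃ Zs))

_≅H_ : {X : Set} → Hypergraph X → Hypergraph X → Set₁
_≅H_ {X} H K = (Vert H ≋ Vert K)
             × ((Z : Subset X) → (Edge H Z → Edge K Z) × (Edge K Z → Edge H Z))

IsDisjointCompleteUnion : {X J : Set} → Hypergraph X → (J → Hypergraph X) → Set₁
IsDisjointCompleteUnion {X} {J} H Hs =
    ((j k : J) → j ≢ k → Disjoint (Vert (Hs j)) (Vert (Hs k)))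
  × (H ≅H completeUnion Hs)

-- Realisations of an isolated complete type are definable, and any two of them satisfy the same
-- unary predicates, so the transposition swapping them is an automorphism. Given elementary
-- submodels N_j, the set Y consisting of the pieces N_j ∩ A_j and of everything outside ⋃ A_j
-- passes the Tarski–Vaught test: a witness a ∈ A_j ∖ N_j can be replaced by a realisation
-- b ∈ N_j of the formula isolating p_j that avoids the parameters, because the transposition of
-- a and b fixes the parameters. As Y ∩ ⋃ A_j = ⋃ (N_j ∩ A_j), every edge of the complete union
-- is an edge of the restriction; the converse is set algebra, and disjointness holds because
-- complete types sharing a realisation coincide.
module Submission where

open import Defs
open import Level using (Level; 0ℓ)
import Level
open import Data.Nat using (ℕ; zero; suc)
open import Data.Fin using (Fin; zero; suc; lift)
open import Data.Product using (Σ; Σ-syntax; _×_; _,_; proj₁; proj₂)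
open import Data.Sum using (_⊎_; inj₁; inj₂)
open import Data.Empty using (⊥-elim)
open import Data.Unit using (tt)
open import Function using (_∘_)
open import Function.Bundles using (_⇔_; mk⇔; Equivalence)
open import Function.Construct.Identity using (⇔-id)
open import Function.Construct.Symmetry using (⇔-sym)
open import Function.Related.TypeIsomorphisms using (→-cong-⇔)
open import Data.Product.Function.NonDependent.Propositional using (_×-⇔_)
open import Data.Sum.Function.Propositional using (_⊎-⇔_)
open import Relation.Nullary using (¬_; yes; no)
open import Relation.Binary.PropositionalEquality using (_≡_; _≢_; refl; sym; trans; cong; subst)
open import Axiom.ExcludedMiddle using (ExcludedMiddle)

open Equivalence using (to; from)

module _ {X : Set} where

  ≋-refl : {A : Subset X} → A ≋ A
  ≋-refl x = (λ a → a) , (λ a → a)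

  ≋-sym : {A B : Subset X} → A ≋ B → B ≋ A
  ≋-sym A≋B x = proj₂ (A≋B x) , proj₁ (A≋B x)

  ≋-trans : {A B C : Subset X} → A ≋ B → B ≋ C → A ≋ C
  ≋-trans A≋B B≋C x = proj₁ (B≋C x) ∘ proj₁ (A≋B x) , proj₂ (A≋B x) ∘ proj₂ (B≋C x)

  ⋃-cong : {J : Set} {A B : J → Subset X} → (∀ j → A j ≋ B j) → ⋃ A ≋ ⋃ B
  ⋃-cong A≋B x = (λ { (j , a) → j , proj₁ (A≋B j x) a }) , (λ { (j , b) → j , proj₂ (A≋B j x) b })

  ∩-⋃-distrib : {J : Set} (Y : Subset X) (A : J → Subset X) → (Y ∩ ⋃ A) ≋ ⋃ (λ j → Y ∩ A j)
  ∩-⋃-distrib Y A x = (λ { (y , j , a) → j , y , a }) , (λ { (j , y , a) → y , j , a })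

restrict-⋃⇒completeUnion : {X J : Set} (H : Hypergraph X) (A : J → Subset X) {Z : Subset X} →
                           Edge (restrict H (⋃ A)) Z → Edge (completeUnion (restrict H ∘ A)) Z
restrict-⋃⇒completeUnion H A (y , y∈H , Z≋) =
  (λ j → y ∩ A j) , (λ j → y , y∈H , ≋-refl) , ≋-trans Z≋ (∩-⋃-distrib y A)

rename : ∀ {P m n} → (Fin m → Fin n) → Formula P m → Formula P n
rename ρ (eq i j)  = eq (ρ i) (ρ j)
rename ρ (rel r i) = rel r (ρ i)
rename ρ fls       = fls
rename ρ (φ ⇒ ψ)   = rename ρ φ ⇒ rename ρ ψ
rename ρ (φ ∧ ψ)   = rename ρ φ ∧ rename ρ ψ
rename ρ (φ ∨ ψ)   = rename ρ φ ∨ rename ρ ψ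
rename ρ (all φ)   = all (rename (lift 1 ρ) φ)
rename ρ (ex φ)    = ex (rename (lift 1 ρ) φ)

⋀ : ∀ {P m} n → (Fin n → Formula P m) → Formula P m
⋀ zero    φ = neg fls
⋀ (suc n) φ = φ zero ∧ ⋀ n (φ ∘ suc)

extend-preserves : {M : Set} (N : Subset M) {n : ℕ} {a : M} {v : Fin n → M} →
                   N a → (∀ i → N (v i)) → ∀ i → N (extend a v i)
extend-preserves N a∈N v∈N zero    = a∈N
extend-preserves N a∈N v∈N (suc i) = v∈N i

extend-lift : {M : Set} {m n : ℕ} (ρ : Fin m → Fin n) {v : Fin n → M} {w : Fin m → M} →
              (∀ i → w i ≡ v (ρ i)) → ∀ a i → extend a w i ≡ extend a v (lift 1 ρ i)
extend-lift ρ w≡ a zero    = refl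
extend-lift ρ w≡ a (suc i) = w≡ i

Maximal : {P : Set} → (Formula P 1 → Set) → Set
Maximal p = ∀ φ → p φ ⊎ p (neg φ)

module _ {P : Set} (𝓜 : Structure P) where

  private
    M = Carrier 𝓜

  definedBy : Formula P 1 → Subset M
  definedBy φ a = Sat 𝓜 φ (oneVar a)

  Sat-rename : ∀ {m n} (ρ : Fin m → Fin n) (φ : Formula P m) (v : Fin n → M) (w : Fin m → M) →
               (∀ i → w i ≡ v (ρ i)) → Sat 𝓜 (rename ρ φ) v ⇔ Sat 𝓜 φ w
  Sat-rename ρ (eq i j)  v w w≡ = mk⇔ (λ e → trans (w≡ i) (trans e (sym (w≡ j))))
                                      (λ e → trans (sym (w≡ i)) (trans e (w≡ j)))
  Sat-rename ρ (rel r i) v w w≡ = mk⇔ (subst (Rel 𝓜 r) (sym (w≡ i))) (subst (Rel 𝓜 r) (w≡ i))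
  Sat-rename ρ fls       v w w≡ = ⇔-id _
  Sat-rename ρ (φ ⇒ ψ)   v w w≡ = →-cong-⇔ (Sat-rename ρ φ v w w≡) (Sat-rename ρ ψ v w w≡)
  Sat-rename ρ (φ ∧ ψ)   v w w≡ = Sat-rename ρ φ v w w≡ ×-⇔ Sat-rename ρ ψ v w w≡
  Sat-rename ρ (φ ∨ ψ)   v w w≡ = Sat-rename ρ φ v w w≡ ⊎-⇔ Sat-rename ρ ψ v w w≡
  Sat-rename ρ (all φ)   v w w≡ = mk⇔
    (λ h a _ → to (Sat-rename (lift 1 ρ) φ _ _ (extend-lift ρ w≡ a)) (h a tt))
    (λ h a _ → from (Sat-rename (lift 1 ρ) φ _ _ (extend-lift ρ w≡ a)) (h a tt))
  Sat-rename ρ (ex φ)    v w w≡ = mk⇔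
    (λ { (a , _ , s) → a , tt , to (Sat-rename (lift 1 ρ) φ _ _ (extend-lift ρ w≡ a)) s })
    (λ { (a , _ , s) → a , tt , from (Sat-rename (lift 1 ρ) φ _ _ (extend-lift ρ w≡ a)) s })

  Sat-⋀ : ∀ {m} n (φ : Fin n → Formula P m) (v : Fin m → M) →
          Sat 𝓜 (⋀ n φ) v ⇔ (∀ i → Sat 𝓜 (φ i) v)
  Sat-⋀ zero    φ v = mk⇔ (λ _ ()) (λ _ f → f)
  Sat-⋀ (suc n) φ v = mk⇔
    (λ { (s , ss) zero → s ; (s , ss) (suc i) → to (Sat-⋀ n (φ ∘ suc) v) ss i })
    (λ h → h zero , from (Sat-⋀ n (φ ∘ suc) v) (h ∘ suc))

  record Automorphism : Set where
    field
      σ           : M → M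
      σ⁻¹         : M → M
      σ-σ⁻¹       : ∀ x → σ (σ⁻¹ x) ≡ x
      σ-injective : ∀ {x y} → σ x ≡ σ y → x ≡ y
      σ-Rel       : ∀ r x → Rel 𝓜 r x ⇔ Rel 𝓜 r (σ x)

  Sat-automorphism : (α : Automorphism) → let open Automorphism α in
                     ∀ {n} (φ : Formula P n) (v w : Fin n → M) →
                     (∀ i → w i ≡ σ (v i)) → Sat 𝓜 φ v ⇔ Sat 𝓜 φ w
  Sat-automorphism α = go
    where
    open Automorphism α

    extend-σ : ∀ {n} {a b} {v w : Fin n → M} → b ≡ σ a → (∀ i → w i ≡ σ (v i)) →
               ∀ i → extend b w i ≡ σ (extend a v i)
    extend-σ b≡ w≡ zero    = b≡
    extend-σ b≡ w≡ (suc i) = w≡ i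

    go : ∀ {n} (φ : Formula P n) (v w : Fin n → M) → (∀ i → w i ≡ σ (v i)) → Sat 𝓜 φ v ⇔ Sat 𝓜 φ w
    go (eq i j)  v w w≡ = mk⇔ (λ e → trans (w≡ i) (trans (cong σ e) (sym (w≡ j))))
                              (λ e → σ-injective (trans (sym (w≡ i)) (trans e (w≡ j))))
    go (rel r i) v w w≡ = mk⇔ (subst (Rel 𝓜 r) (sym (w≡ i)) ∘ to (σ-Rel r (v i)))
                              (from (σ-Rel r (v i)) ∘ subst (Rel 𝓜 r) (w≡ i))
    go fls       v w w≡ = ⇔-id _
    go (φ ⇒ ψ)   v w w≡ = →-cong-⇔ (go φ v w w≡) (go ψ v w w≡)
    go (φ ∧ ψ)   v w w≡ = go φ v w w≡ ×-⇔ go ψ v w w≡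
    go (φ ∨ ψ)   v w w≡ = go φ v w w≡ ⊎-⇔ go ψ v w w≡
    go (all φ)   v w w≡ = mk⇔
      (λ h b _ → to (go φ _ _ (extend-σ (sym (σ-σ⁻¹ b)) w≡)) (h (σ⁻¹ b) tt))
      (λ h a _ → from (go φ _ _ (extend-σ refl w≡)) (h (σ a) tt))
    go (ex φ)    v w w≡ = mk⇔
      (λ { (a , _ , s) → σ a , tt , to (go φ _ _ (extend-σ refl w≡)) s })
      (λ { (b , _ , s) → σ⁻¹ b , tt , from (go φ _ _ (extend-σ (sym (σ-σ⁻¹ b)) w≡)) s })

  id-automorphism : Automorphism
  id-automorphism = record
    { σ = λ x → x ; σ⁻¹ = λ x → x ; σ-σ⁻¹ = λ _ → refl ; σ-injective = λ e → e ; σ-Rel = λ _ _ → ⇔-id _ }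

  Sat-cong : ∀ {n} (φ : Formula P n) {v w : Fin n → M} → (∀ i → w i ≡ v i) → Sat 𝓜 φ v → Sat 𝓜 φ w
  Sat-cong φ w≡ = to (Sat-automorphism id-automorphism φ _ _ w≡)

  module _ (em : ExcludedMiddle 0ℓ) (a b : M) where

    transpose : M → M
    transpose x with em {x ≡ a} | em {x ≡ b}
    ... | yes _ | _     = b
    ... | no _  | yes _ = a
    ... | no _  | no _  = x

    transpose-a : transpose a ≡ b
    transpose-a with em {a ≡ a}
    ... | yes _   = refl
    ... | no a≢a = ⊥-elim (a≢a refl)

    transpose-b : transpose b ≡ a
    transpose-b with em {b ≡ a} | em {b ≡ b}
    ... | yes b≡a | _       = b≡a
    ... | no _    | yes _   = refl
    ... | no _    | no b≢b = ⊥-elim (b≢b refl)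

    transpose-fixes : ∀ x → x ≢ a → x ≢ b → transpose x ≡ x
    transpose-fixes x x≢a x≢b with em {x ≡ a} | em {x ≡ b}
    ... | yes x≡a | _       = ⊥-elim (x≢a x≡a)
    ... | no _    | yes x≡b = ⊥-elim (x≢b x≡b)
    ... | no _    | no _    = refl

    transpose-involutive : ∀ x → transpose (transpose x) ≡ x
    transpose-involutive x with em {x ≡ a} | em {x ≡ b}
    ... | yes x≡a | _       = trans transpose-b (sym x≡a)
    ... | no _    | yes x≡b = trans transpose-a (sym x≡b)
    ... | no x≢a  | no x≢b  = transpose-fixes x x≢a x≢b

    transpose-injective : ∀ {x y} → transpose x ≡ transpose y → x ≡ y
    transpose-injective {x} {y} e =
      trans (sym (transpose-involutive x)) (trans (cong transpose e) (transpose-involutive y))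

    module _ (a∼b : ∀ r → Rel 𝓜 r a ⇔ Rel 𝓜 r b) where

      transpose-Rel : ∀ r x → Rel 𝓜 r x ⇔ Rel 𝓜 r (transpose x)
      transpose-Rel r x with em {x ≡ a} | em {x ≡ b}
      ... | yes refl | _        = a∼b r
      ... | no _     | yes refl = ⇔-sym (a∼b r)
      ... | no _     | no _     = ⇔-id _

      transposition : Automorphism
      transposition = record
        { σ = transpose ; σ⁻¹ = transpose ; σ-σ⁻¹ = transpose-involutive
        ; σ-injective = transpose-injective ; σ-Rel = transpose-Rel }

  TarskiVaught : Subset M → Set
  TarskiVaught N = ∀ {n} (ψ : Formula P (suc n)) (v : Fin n → M) → (∀ i → N (v i)) →
                   ∀ a → Sat 𝓜 ψ (extend a v) → Σ[ b ∈ M ] (N b × Sat 𝓜 ψ (extend b v))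

  tarskiVaught : ExcludedMiddle 0ℓ → {N : Subset M} → TarskiVaught N →
                 IsElementarySubmodelUniverse 𝓜 N
  tarskiVaught em {N} tv = nonempty , λ n φ v v∈N → to (SatIn⇔Sat φ v v∈N) , from (SatIn⇔Sat φ v v∈N)
    where
    nonempty : Σ[ a ∈ M ] N a
    nonempty with tv {0} (eq zero zero) (λ ()) (λ ()) (point 𝓜) refl
    ... | a , a∈N , _ = a , a∈N

    SatIn⇔Sat : ∀ {n} (φ : Formula P n) (v : Fin n → M) → (∀ i → N (v i)) →
                SatIn (Rel 𝓜) N φ v ⇔ Sat 𝓜 φ v
    SatIn⇔Sat (eq i j)  v v∈N = ⇔-id _
    SatIn⇔Sat (rel r i) v v∈N = ⇔-id _
    SatIn⇔Sat fls       v v∈N = ⇔-id _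
    SatIn⇔Sat (φ ⇒ ψ)   v v∈N = →-cong-⇔ (SatIn⇔Sat φ v v∈N) (SatIn⇔Sat ψ v v∈N)
    SatIn⇔Sat (φ ∧ ψ)   v v∈N = SatIn⇔Sat φ v v∈N ×-⇔ SatIn⇔Sat ψ v v∈N
    SatIn⇔Sat (φ ∨ ψ)   v v∈N = SatIn⇔Sat φ v v∈N ⊎-⇔ SatIn⇔Sat ψ v v∈N
    SatIn⇔Sat (all φ)   v v∈N = mk⇔ forall-in-M
      (λ h a a∈N → from (SatIn⇔Sat φ _ (extend-preserves N a∈N v∈N)) (h a tt))
      where
      -- a counterexample in M would have one in N, by the Tarski–Vaught test applied to ¬φ
      forall-in-M : SatIn (Rel 𝓜) N (all φ) v → Sat 𝓜 (all φ) v
      forall-in-M h a _ with em {Sat 𝓜 φ (extend a v)}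
      ... | yes s = s
      ... | no ¬s with tv (neg φ) v v∈N a ¬s
      ... | b , b∈N , ¬sb = ⊥-elim (¬sb (to (SatIn⇔Sat φ _ (extend-preserves N b∈N v∈N)) (h b b∈N)))
    SatIn⇔Sat (ex φ)    v v∈N = mk⇔
      (λ { (a , a∈N , s) → a , tt , to (SatIn⇔Sat φ _ (extend-preserves N a∈N v∈N)) s })
      (λ { (a , _ , s) → witness-in-N (tv φ v v∈N a s) })
      where
      witness-in-N : Σ[ b ∈ M ] (N b × Sat 𝓜 φ (extend b v)) → SatIn (Rel 𝓜) N (ex φ) v
      witness-in-N (b , b∈N , s) = b , b∈N , from (SatIn⇔Sat φ _ (extend-preserves N b∈N v∈N)) s

  elementary-avoiding-witness :
    {N : Subset M} → IsElementarySubmodelUniverse 𝓜 N →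
    (φ : Formula P 1) {a : M} → definedBy φ a →
    ∀ {n} (w : Fin n → M) → (∀ i → N (w i)) → (∀ i → w i ≢ a) →
    Σ[ b ∈ M ] (N b × definedBy φ b × (∀ i → w i ≢ b))
  elementary-avoiding-witness {N} (_ , elem) φ {a} φa {n} w w∈N w≢a =
    b , b∈N , to (Sat-rename (λ _ → zero) φ _ (oneVar b) (λ { zero → refl })) (proj₁ χb)
      , λ i e → to (Sat-⋀ n _ (extend b w)) (proj₂ χb) i (sym e)
    where
    χ : Formula P (suc n)
    χ = rename (λ _ → zero) φ ∧ ⋀ n (λ i → neg (eq zero (suc i)))

    χa : Sat 𝓜 (ex χ) w
    χa = a , tt , from (Sat-rename (λ _ → zero) φ _ (oneVar a) (λ { zero → refl })) φa
                , from (Sat-⋀ n _ (extend a w)) (λ i e → w≢a i (sym e))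

    χ-in-N : SatIn (Rel 𝓜) N (ex χ) w
    χ-in-N = proj₂ (elem n (ex χ) w w∈N) χa

    b : M
    b = proj₁ χ-in-N

    b∈N : N b
    b∈N = proj₁ (proj₂ χ-in-N)

    χb : Sat 𝓜 χ (extend b w)
    χb = proj₁ (elem (suc n) χ (extend b w) (extend-preserves N b∈N w∈N)) (proj₂ (proj₂ χ-in-N))

  module _ (em : ExcludedMiddle 0ℓ) (N : Subset M) {c : M} (c∈N : N c) where

    retract : M → M
    retract x with em {N x}
    ... | yes _ = x
    ... | no _  = c

    retract-∈ : ∀ x → N (retract x)
    retract-∈ x with em {N x}
    ... | yes x∈N = x∈N
    ... | no _    = c∈N

    retract-id : ∀ {x} → N x → retract x ≡ x
    retract-id {x} x∈N with em {N x}
    ... | yes _   = refl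
    ... | no x∉N = ⊥-elim (x∉N x∈N)

    retract-≢ : ∀ {x a} → x ≢ a → c ≢ a → retract x ≢ a
    retract-≢ {x} x≢a c≢a with em {N x}
    ... | yes _ = x≢a
    ... | no _  = c≢a

  elementary-fresh-witness :
    ExcludedMiddle 0ℓ → {N : Subset M} → IsElementarySubmodelUniverse 𝓜 N →
    (φ : Formula P 1) {a : M} → definedBy φ a → ¬ N a →
    ∀ {n} (v : Fin n → M) → (∀ i → v i ≢ a) →
    Σ[ b ∈ M ] (N b × definedBy φ b × (∀ i → v i ≢ b))
  elementary-fresh-witness em {N} N-elem@((c , c∈N) , _) φ {a} φa a∉N v v≢a = fresh witness
    where
    c≢a : c ≢ a
    c≢a c≡a = a∉N (subst N c≡a c∈N)

    witness : Σ[ b ∈ M ] (N b × definedBy φ b × (∀ i → retract em N c∈N (v i) ≢ b))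
    witness = elementary-avoiding-witness N-elem φ φa (retract em N c∈N ∘ v) (λ i → retract-∈ em N c∈N (v i))
                (λ i → retract-≢ em N c∈N (v≢a i) c≢a)

    -- a parameter equal to b lies in N, so the retraction leaves it in place
    fresh : Σ[ b ∈ M ] (N b × definedBy φ b × (∀ i → retract em N c∈N (v i) ≢ b)) →
            Σ[ b ∈ M ] (N b × definedBy φ b × (∀ i → v i ≢ b))
    fresh (b , b∈N , φb , r≢b) =
      b , b∈N , φb , λ i vi≡b → r≢b i (trans (retract-id em N c∈N (subst N (sym vi≡b) b∈N)) vi≡b)

  maximal-realisers-agree : {p : Formula P 1 → Set} → Maximal p → {a b : M} →
                            Realises 𝓜 p a → Realises 𝓜 p b → ∀ ψ → definedBy ψ a → definedBy ψ b
  maximal-realisers-agree max a⊨p b⊨p ψ ψa with max ψ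
  ... | inj₁ ψ∈p  = b⊨p ψ ψ∈p
  ... | inj₂ ¬ψ∈p = ⊥-elim (a⊨p _ ¬ψ∈p ψa)

  maximal-realisers-Rel : {p : Formula P 1 → Set} → Maximal p → {a b : M} →
                          Realises 𝓜 p a → Realises 𝓜 p b → ∀ r → Rel 𝓜 r a ⇔ Rel 𝓜 r b
  maximal-realisers-Rel max a⊨p b⊨p r =
    mk⇔ (maximal-realisers-agree max a⊨p b⊨p (rel r zero))
        (maximal-realisers-agree max b⊨p a⊨p (rel r zero))

  realised-⊆-maximal : {p q : Formula P 1 → Set} → Maximal q → {a : M} →
                       Realises 𝓜 p a → Realises 𝓜 q a → ∀ ψ → p ψ → q ψ
  realised-⊆-maximal max a⊨p a⊨q ψ ψ∈p with max ψ
  ... | inj₁ ψ∈q  = ψ∈q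
  ... | inj₂ ¬ψ∈q = ⊥-elim (a⊨q _ ¬ψ∈q (a⊨p ψ ψ∈p))

  maximal-realisations-≋ : {p q : Formula P 1 → Set} → Maximal p → Maximal q → {a : M} →
                           Realises 𝓜 p a → Realises 𝓜 q a → Realisations 𝓜 p ≋ Realisations 𝓜 q
  maximal-realisations-≋ max-p max-q a⊨p a⊨q x =
    (λ x⊨p ψ ψ∈q → x⊨p ψ (realised-⊆-maximal max-p a⊨q a⊨p ψ ψ∈q))
    , (λ x⊨q ψ ψ∈p → x⊨q ψ (realised-⊆-maximal max-q a⊨p a⊨q ψ ψ∈p))

  isolated-realisations : {T : Theory P} → 𝓜 ⊨T T → {p : Formula P 1 → Set} →
                          ((φ , _) : Isolated T p) → Realisations 𝓜 p ≋ definedBy φ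
  isolated-realisations 𝓜⊨T (φ , φ∈p , φ⊢p) a =
    (λ a⊨p → a⊨p φ φ∈p)
    , λ φa ψ ψ∈p → Sat-cong ψ one≡ (φ⊢p ψ ψ∈p 𝓜 𝓜⊨T a tt (Sat-cong φ (sym ∘ one≡) φa))
    where
    one≡ : ∀ i → oneVar a i ≡ extend a noVars i
    one≡ zero = refl

  patch : {J : Set} → (J → Subset M) → (J → Subset M) → Subset M
  patch A N x = ⋃ (λ j → N j ∩ A j) x ⊎ ¬ ⋃ A x

  patch-∩-⋃ : {J : Set} (A N : J → Subset M) → (patch A N ∩ ⋃ A) ≋ ⋃ (λ j → N j ∩ A j)
  patch-∩-⋃ A N x =
    (λ { (inj₁ x∈NA , _) → x∈NA ; (inj₂ x∉A , x∈A) → ⊥-elim (x∉A x∈A) })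
    , (λ { (j , x∈N , x∈A) → inj₁ (j , x∈N , x∈A) , (j , x∈A) })

  module _ (em : ExcludedMiddle 0ℓ) {J : Set} (A : J → Subset M)
           (φ : J → Formula P 1) (A≋φ : ∀ j → A j ≋ definedBy (φ j))
           (homogeneous : ∀ j {a b} → A j a → A j b → ∀ r → Rel 𝓜 r a ⇔ Rel 𝓜 r b) where

    patch-tarskiVaught : (N : J → Subset M) → (∀ j → IsElementarySubmodelUniverse 𝓜 (N j)) →
                         TarskiVaught (patch A N)
    patch-tarskiVaught N N-elem {n} ψ v v∈Y a ψa with em {⋃ A a}
    ... | no a∉A = a , inj₂ a∉A , ψa
    ... | yes (j , a∈A) with em {Σ[ i ∈ Fin n ] v i ≡ a}
    ... | yes (i , refl) = a , v∈Y i , ψa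
    ... | no a∉v with em {N j a}
    ... | yes a∈N = a , inj₁ (j , a∈N , a∈A) , ψa
    ... | no a∉N with elementary-fresh-witness em (N-elem j) (φ j) (proj₁ (A≋φ j a) a∈A) a∉N v
                        (λ i vi≡a → a∉v (i , vi≡a))
    ... | b , b∈N , φb , v≢b = b , inj₁ (j , b∈N , b∈A) , to (Sat-automorphism swap ψ _ _ swap-extend) ψa
      where
      b∈A : A j b
      b∈A = proj₂ (A≋φ j b) φb

      swap : Automorphism
      swap = transposition em a b (homogeneous j a∈A b∈A)

      swap-extend : ∀ i → extend b v i ≡ transpose em a b (extend a v i)
      swap-extend zero    = sym (transpose-a em a b)
      swap-extend (suc i) = sym (transpose-fixes em a b (v i) (λ vi≡a → a∉v (i , vi≡a)) (v≢b i))

    completeUnion⇒restrict-⋃ : {Z : Subset M} →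
                               Edge (completeUnion (restrict (HM 𝓜) ∘ A)) Z → Edge (restrict (HM 𝓜) (⋃ A)) Z
    completeUnion⇒restrict-⋃ (Zs , Zs∈H , Z≋⋃Zs) =
      patch A N , Level.lift (tarskiVaught em (patch-tarskiVaught N N-elem))
      , ≋-trans Z≋⋃Zs (≋-trans (⋃-cong (λ j → proj₂ (proj₂ (Zs∈H j)))) (≋-sym (patch-∩-⋃ A N)))
      where
      N : J → Subset M
      N j = proj₁ (Zs∈H j)

      N-elem : ∀ j → IsElementarySubmodelUniverse 𝓜 (N j)
      N-elem j = Level.lower (proj₁ (proj₂ (Zs∈H j)))

mainTheorem12 : ((ℓ : Level) → ExcludedMiddle ℓ) →
    {P : Set} (T : Theory P) → Complete T →
    (𝓜 : Structure P) → 𝓜 ⊨T T →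
    {J : Set} (p : J → Formula P 1 → Set) →
    ((j : J) → IsOneType T (p j) × Isolated T (p j)) →
    ((j k : J) → j ≢ k → ¬ (Realisations 𝓜 (p j) ≋ Realisations 𝓜 (p k))) →
    IsDisjointCompleteUnion
    (restrict (HM 𝓜) (⋃ (λ j → Realisations 𝓜 (p j))))
    (λ j → restrict (HM 𝓜) (Realisations 𝓜 (p j)))
mainTheorem12 em {P} T _ 𝓜 𝓜⊨T {J} p types distinct =
  disjoint
  , ≋-refl
  , λ Z → restrict-⋃⇒completeUnion (HM 𝓜) A
        , completeUnion⇒restrict-⋃ 𝓜 (em 0ℓ) A φ A≋φ homogeneous
  where
  A : J → Subset (Carrier 𝓜)
  A j = Realisations 𝓜 (p j)

  maximal : ∀ j → Maximal (p j)
  maximal j = proj₂ (proj₁ (types j))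

  φ : J → Formula P 1
  φ j = proj₁ (proj₂ (types j))

  A≋φ : ∀ j → A j ≋ definedBy 𝓜 (φ j)
  A≋φ j = isolated-realisations 𝓜 𝓜⊨T (proj₂ (types j))

  homogeneous : ∀ j {a b} → A j a → A j b → ∀ r → Rel 𝓜 r a ⇔ Rel 𝓜 r b
  homogeneous j = maximal-realisers-Rel 𝓜 (maximal j)

  disjoint : ∀ j k → j ≢ k → Disjoint (A j) (A k)
  disjoint j k j≢k x x∈Aj x∈Ak =
    distinct j k j≢k (maximal-realisations-≋ 𝓜 (maximal j) (maximal k) x∈Aj x∈Ak)
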